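{- Let $\mathcal C(\Lambda_1)=\{c_M=(\mathrm{Tr}(X_1M),\dots,\mathrm{Tr}(X_NM)):M\in M_{n+1}(q)\}$ be the linear code associated to the projective system $\Lambda_1=\{[X_1],\dots,[X_N]\}\subseteq\mathrm{PG}(M_{n+1}(q))$ of all points $[x\xi]$ with $x$ a nonzero column vector, $\xi$ a nonzero row vector in $\mathbb F_q^{n+1}$ and $\xi x=0$. Then $\mathcal C(\Lambda_1)$ admits the group $\mathrm{PGL}(n+1,q)$ as a group of automorphisms (acting via $c_M\mapsto c_{g^{ -1}Mg}$ for $g\in\mathrm{GL}(n+1,q)$), and this group acts transitively on the components (coordinate positions) of the codewords.
   Context: An automorphism of a linear code is a linear map of the code onto itself preserving the Hamming weight of every codeword. -}

module Defs where

open import Level using (0ℓ)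
open import Data.Nat using (ℕ; suc)
import Data.Nat as ℕ
open import Data.Fin using (Fin)
open import Data.Product using (Σ; ∃; _×_; _,_)
open import Relation.Nullary using (¬_; Dec; does)
open import Relation.Binary.PropositionalEquality using (_≡_; _≢_)
open import Algebra.Structures using (IsCommutativeRing)
open import Function.Bundles using (_↔_)
open import Data.Bool using (if_then_else_)

record FiniteField (q : ℕ) : Set₁ where
  infixl 6 _+_
  infixl 7 _*_
  field
    Carrier : Set
    _+_ _*_ : Carrier → Carrier → Carrier
    -_      : Carrier → Carrier
    0# 1#   : Carrier
    isCommutativeRing : IsCommutativeRing _≡_ _+_ _*_ -_ 0# 1#
    0≢1     : 0# ≢ 1#
    inverse : ∀ x → x ≢ 0# → ∃ λ y → x * y ≡ 1#
    _≟_     : (x y : Carrier) → Dec (x ≡ y)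
    enum    : Carrier ↔ Fin q

module LinAlg {q : ℕ} (F : FiniteField q) where
  open FiniteField F

  Σ[_] : ∀ {m} → (Fin m → Carrier) → Carrier
  Σ[_] {ℕ.zero} f = 0#
  Σ[_] {suc m} f = f Fin.zero + Σ[_] (λ i → f (Fin.suc i))
    where import Data.Fin as Fin

  Vector : ℕ → Set
  Vector m = Fin m → Carrier

  Mat : ℕ → Set
  Mat m = Fin m → Fin m → Carrier

  NonZeroVec : ∀ {m} → Vector m → Set
  NonZeroVec v = ¬ (∀ k → v k ≡ 0#)

  _·_ : ∀ {m} → Vector m → Vector m → Carrier
  ξ · x = Σ[ (λ k → ξ k * x k) ]

  outer : ∀ {m} → Vector m → Vector m → Mat m
  outer x ξ i j = x i * ξ j

  _⊗_ : ∀ {m} → Mat m → Mat m → Mat m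
  (A ⊗ B) i j = Σ[ (λ k → A i k * B k j) ]

  I : ∀ {m} → Mat m
  I i j = if does (i Data.Fin.≟ j) then 1# else 0#
    where import Data.Fin

  scale : ∀ {m} → Carrier → Mat m → Mat m
  scale c A i j = c * A i j

  _≈M_ : ∀ {m} → Mat m → Mat m → Set
  A ≈M B = ∀ i j → A i j ≡ B i j

  Tr : ∀ {m} → Mat m → Carrier
  Tr A = Σ[ (λ k → A k k) ]

  InversePair : ∀ {m} → Mat m → Mat m → Set
  InversePair g h = (g ⊗ h) ≈M I × (h ⊗ g) ≈M I

  -- g is a (nonzero) scalar matrix, i.e. trivial in PGL
  IsScalar : ∀ {m} → Mat m → Set
  IsScalar g = ∃ λ c → g ≈M scale c I

  -- A and B represent the same projective point: A = λ B, λ ≠ 0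
  Proportional : ∀ {m} → Mat m → Mat m → Set
  Proportional A B = ∃ λ c → c ≢ 0# × A ≈M scale c B

  InΛ₁ : ∀ {m} → Mat m → Set
  InΛ₁ {m} X = Σ (Vector m) λ x → Σ (Vector m) λ ξ →
    NonZeroVec x × NonZeroVec ξ × ξ · x ≡ 0# × X ≈M outer x ξ

  -- X : Fin N → Mat m enumerates representatives X_1..X_N of the points of
  -- Λ₁, each point exactly once.
  IsΛ₁System : ∀ {m N} → (Fin N → Mat m) → Set
  IsΛ₁System {m} {N} X =
      (∀ i → InΛ₁ (X i))
    × (∀ i j → Proportional (X i) (X j) → i ≡ j)
    × (∀ (x ξ : Vector m) → NonZeroVec x → NonZeroVec ξ → ξ · x ≡ 0# →
         ∃ λ i → Proportional (X i) (outer x ξ))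

  codeword : ∀ {m N} → (Fin N → Mat m) → Mat m → Fin N → Carrier
  codeword X M i = Tr (X i ⊗ M)

  weight : ∀ {N} → (Fin N → Carrier) → ℕ
  weight {ℕ.zero} w = ℕ.zero
  weight {suc N} w =
    (if does (w Data.Fin.zero ≟ 0#) then ℕ.zero else 1)
      ℕ.+ weight (λ i → w (Data.Fin.suc i))
    where import Data.Fin

{-# OPTIONS --safe #-}
-- Writing X_i = x_i ξ_i, the i-th coordinate of c_M is Tr(x_i ξ_i M) = ξ_i M x_i, so the
-- i-th coordinate of c_{g⁻¹Mg} is the same functional evaluated at the flag
-- (g x_i, ξ_i g⁻¹) instead of (x_i, ξ_i). Since GL(n+1,q) permutes the flags
-- (point x, hyperplane ξ through it) and Λ₁ lists every flag once up to scalars,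
-- c_M ↦ c_{g⁻¹Mg} permutes the coordinates up to nonzero factors, so it preserves
-- weights. Scalar matrices fix every flag; conversely a matrix fixing the flags
-- (e_k, e_l), k ≠ l, is scalar. For transitivity, one transvection moves any point
-- to any other, and a second one fixing that point moves any hyperplane through it
-- to any other.
module Submission where

open import Defs
open import Level using (0ℓ)
open import Data.Nat as ℕ using (ℕ; zero; suc)
open import Data.Nat.Properties using (+-0-commutativeMonoid)
open import Data.Fin using (Fin; zero; suc)
open import Data.Fin.Properties using (¬∀⟶∃¬) renaming (_≟_ to _≟ᶠ_)
open import Data.Fin.Permutation using (permutation)
open import Data.Product using (∃; _×_; _,_; proj₁; proj₂; swap)
open import Data.Bool using (if_then_else_)
open import Data.Empty using (⊥-elim)
open import Data.Vec.Functional using (map)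
open import Function using (_∘_; flip; _⇔_; mk⇔)
open import Relation.Nullary using (does; yes; no)
open import Relation.Nullary.Decidable using (does-⇔)
open import Relation.Binary.PropositionalEquality
open import Relation.Binary.Bundles using (Setoid)
import Relation.Binary.Reasoning.Setoid as SetoidReasoning
open import Algebra.Bundles using (CommutativeRing)
open import Algebra.Structures using (IsCommutativeRing)
import Algebra.Properties.CommutativeMonoid.Sum as CommutativeMonoidSum

module ℕΣ = CommutativeMonoidSum +-0-commutativeMonoid

module _ {q : ℕ} (F : FiniteField q) where
  open FiniteField F
  open LinAlg F
  open IsCommutativeRing isCommutativeRing
    using (+-identityˡ; +-identityʳ; *-identityˡ; *-identityʳ; zeroˡ; zeroʳ;
           *-comm; *-assoc; distribˡ; distribʳ; -‿inverseˡ; -‿inverseʳ)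

  commutativeRing : CommutativeRing 0ℓ 0ℓ
  commutativeRing = record { isCommutativeRing = isCommutativeRing }

  open CommutativeRing commutativeRing using (ring; semiring; commutativeSemiring)
  open import Algebra.Solver.Ring.NaturalCoefficients.Default commutativeSemiring
    using (solve; _:=_; _:+_; _:*_)
  open import Algebra.Properties.Ring ring
    using (-‿distribˡ-*; -‿distribʳ-*; -1*x≈-x; -0#≈0#)
  open import Algebra.Properties.Semiring.Sum semiring
    using (sum; sum-cong-≗; sum-replicate-zero; ∑-distrib-+; ∑-comm; *-distribˡ-sum)
  open ≡-Reasoning

  inverse-cancelˡ : ∀ {c c'} a → c * c' ≡ 1# → c' * (c * a) ≡ a
  inverse-cancelˡ {c} {c'} a c*c'≡1 = begin
    c' * (c * a)  ≡⟨ solve 3 (λ c c' a → c' :* (c :* a) := (c :* c') :* a) refl c c' a ⟩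
    (c * c') * a  ≡⟨ cong (_* a) c*c'≡1 ⟩
    1# * a        ≡⟨ *-identityˡ a ⟩
    a             ∎

  *-cancelˡ-≢0 : ∀ {c a b} → c ≢ 0# → c * a ≡ c * b → a ≡ b
  *-cancelˡ-≢0 {c} {a} {b} c≢0 ca≡cb = begin
    a              ≡⟨ inverse-cancelˡ a c*c⁻¹≡1 ⟨
    c⁻¹ * (c * a)  ≡⟨ cong (c⁻¹ *_) ca≡cb ⟩
    c⁻¹ * (c * b)  ≡⟨ inverse-cancelˡ b c*c⁻¹≡1 ⟩
    b              ∎
    where
    c⁻¹ = proj₁ (inverse c c≢0)
    c*c⁻¹≡1 = proj₂ (inverse c c≢0)

  ≢0*x≡0⇒x≡0 : ∀ {c a} → c ≢ 0# → c * a ≡ 0# → a ≡ 0#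
  ≢0*x≡0⇒x≡0 {c} c≢0 ca≡0 = *-cancelˡ-≢0 c≢0 (trans ca≡0 (sym (zeroʳ c)))

  *-≢0 : ∀ {a b} → a ≢ 0# → b ≢ 0# → a * b ≢ 0#
  *-≢0 a≢0 b≢0 ab≡0 = b≢0 (≢0*x≡0⇒x≡0 a≢0 ab≡0)

  *≡1⇒≢0 : ∀ {a b} → a * b ≡ 1# → b ≢ 0#
  *≡1⇒≢0 {a} ab≡1 b≡0 = 0≢1 (trans (sym (zeroʳ a)) (trans (cong (a *_) (sym b≡0)) ab≡1))

  ≢0-resp : ∀ {a b} → a ≡ b → b ≢ 0# → a ≢ 0#
  ≢0-resp a≡b b≢0 = b≢0 ∘ trans (sym a≡b)

  Σ≡sum : ∀ {m} (f : Vector m) → Σ[ f ] ≡ sum f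
  Σ≡sum {zero}  f = refl
  Σ≡sum {suc m} f = cong (f zero +_) (Σ≡sum (f ∘ suc))

  Σ-cong : ∀ {m} {f g : Vector m} → f ≗ g → Σ[ f ] ≡ Σ[ g ]
  Σ-cong {f = f} {g} f≗g = begin
    Σ[ f ]  ≡⟨ Σ≡sum f ⟩
    sum f   ≡⟨ sum-cong-≗ f≗g ⟩
    sum g   ≡⟨ Σ≡sum g ⟨
    Σ[ g ]  ∎

  Σ-zero : ∀ m → Σ[ (λ (_ : Fin m) → 0#) ] ≡ 0#
  Σ-zero m = trans (Σ≡sum {m} _) (sum-replicate-zero m)

  Σ-+ : ∀ {m} (f g : Vector m) → Σ[ (λ i → f i + g i) ] ≡ Σ[ f ] + Σ[ g ]
  Σ-+ f g = begin
    Σ[ (λ i → f i + g i) ]  ≡⟨ Σ≡sum (λ i → f i + g i) ⟩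
    sum (λ i → f i + g i)   ≡⟨ ∑-distrib-+ f g ⟩
    sum f + sum g           ≡⟨ cong₂ _+_ (Σ≡sum f) (Σ≡sum g) ⟨
    Σ[ f ] + Σ[ g ]         ∎

  Σ-*ˡ : ∀ {m} c (f : Vector m) → Σ[ (λ i → c * f i) ] ≡ c * Σ[ f ]
  Σ-*ˡ c f = begin
    Σ[ (λ i → c * f i) ]  ≡⟨ Σ≡sum (λ i → c * f i) ⟩
    sum (λ i → c * f i)   ≡⟨ *-distribˡ-sum c f ⟨
    c * sum f             ≡⟨ cong (c *_) (Σ≡sum f) ⟨
    c * Σ[ f ]            ∎

  Σ-*ʳ : ∀ {m} c (f : Vector m) → Σ[ (λ i → f i * c) ] ≡ Σ[ f ] * c
  Σ-*ʳ c f = trans (Σ-cong (λ i → *-comm (f i) c)) (trans (Σ-*ˡ c f) (*-comm c _))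

  Σ-comm : ∀ {m n} (f : Fin m → Fin n → Carrier) →
           Σ[ (λ i → Σ[ f i ]) ] ≡ Σ[ (λ j → Σ[ (λ i → f i j) ]) ]
  Σ-comm f = begin
    Σ[ (λ i → Σ[ f i ]) ]            ≡⟨ Σ≡sum₂ f ⟩
    sum (λ i → sum (f i))            ≡⟨ ∑-comm f ⟩
    sum (λ j → sum (λ i → f i j))    ≡⟨ Σ≡sum₂ (flip f) ⟨
    Σ[ (λ j → Σ[ (λ i → f i j) ]) ]  ∎
    where
    Σ≡sum₂ : ∀ {m n} (g : Fin m → Fin n → Carrier) →
             Σ[ (λ i → Σ[ g i ]) ] ≡ sum (λ i → sum (g i))
    Σ≡sum₂ g = trans (Σ-cong (λ i → Σ≡sum (g i))) (Σ≡sum (λ i → sum (g i)))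

  I-diag : ∀ {m} (i : Fin m) → I i i ≡ 1#
  I-diag i with i ≟ᶠ i
  ... | yes _  = refl
  ... | no i≢i = ⊥-elim (i≢i refl)

  I-off : ∀ {m} {i j : Fin m} → i ≢ j → I i j ≡ 0#
  I-off {i = i} {j} i≢j with i ≟ᶠ j
  ... | yes i≡j = ⊥-elim (i≢j i≡j)
  ... | no _    = refl

  I-sym : ∀ {m} (i j : Fin m) → I i j ≡ I j i
  I-sym i j with i ≟ᶠ j
  ... | yes refl = sym (I-diag i)
  ... | no i≢j   = sym (I-off (i≢j ∘ sym))

  Σ-δˡ : ∀ {m} (i : Fin m) (f : Vector m) → Σ[ (λ k → I i k * f k) ] ≡ f i
  Σ-δˡ {suc m} zero f = begin
    1# * f zero + Σ[ (λ k → 0# * f (suc k)) ]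
      ≡⟨ cong₂ _+_ (*-identityˡ (f zero)) (Σ-cong (λ k → zeroˡ (f (suc k)))) ⟩
    f zero + Σ[ (λ (_ : Fin m) → 0#) ]  ≡⟨ cong (f zero +_) (Σ-zero m) ⟩
    f zero + 0#                         ≡⟨ +-identityʳ (f zero) ⟩
    f zero                              ∎
  Σ-δˡ {suc m} (suc i) f = begin
    0# * f zero + Σ[ (λ k → I i k * f (suc k)) ]
      ≡⟨ cong (_+ Σ[ (λ k → I i k * f (suc k)) ]) (zeroˡ (f zero)) ⟩
    0# + Σ[ (λ k → I i k * f (suc k)) ]  ≡⟨ +-identityˡ _ ⟩
    Σ[ (λ k → I i k * f (suc k)) ]       ≡⟨ Σ-δˡ i (f ∘ suc) ⟩
    f (suc i)                            ∎

  Σ-δʳ : ∀ {m} (j : Fin m) (f : Vector m) → Σ[ (λ k → f k * I k j) ] ≡ f j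
  Σ-δʳ j f = trans (Σ-cong (λ k → trans (*-comm (f k) _) (cong (_* f k) (I-sym k j)))) (Σ-δˡ j f)

  infixl 7 _▷_ _◁_

  _▷_ : ∀ {m} → Mat m → Vector m → Vector m
  (A ▷ v) i = A i · v

  _◁_ : ∀ {m} → Vector m → Mat m → Vector m
  (ξ ◁ A) j = ξ · (λ k → A k j)

  e : ∀ {m} → Fin m → Vector m
  e k = I k

  ·-cong : ∀ {m} {a b c d : Vector m} → a ≗ b → c ≗ d → a · c ≡ b · d
  ·-cong a≗b c≗d = Σ-cong (λ k → cong₂ _*_ (a≗b k) (c≗d k))

  ·-comm : ∀ {m} (a b : Vector m) → a · b ≡ b · a
  ·-comm a b = Σ-cong (λ k → *-comm (a k) (b k))

  ·-scaleʳ : ∀ {m} (ξ v : Vector m) c → ξ · (λ k → c * v k) ≡ c * (ξ · v)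
  ·-scaleʳ ξ v c =
    trans (Σ-cong (λ k → solve 3 (λ x c v → x :* (c :* v) := c :* (x :* v)) refl (ξ k) c (v k)))
          (Σ-*ˡ c (λ k → ξ k * v k))

  ·-+ˡ : ∀ {m} (u v a : Vector m) → (λ k → u k + v k) · a ≡ u · a + v · a
  ·-+ˡ u v a =
    trans (Σ-cong (λ k → distribʳ (a k) (u k) (v k))) (Σ-+ (λ k → u k * a k) (λ k → v k * a k))

  ·-neg : ∀ {m} (v u : Vector m) → v · map -_ u ≡ - (v · u)
  ·-neg v u = begin
    v · map -_ u
      ≡⟨ Σ-cong (λ k → trans (-1*x≈-x _) (-‿distribʳ-* (v k) (u k))) ⟨
    Σ[ (λ k → - 1# * (v k * u k)) ]  ≡⟨ Σ-*ˡ (- 1#) (λ k → v k * u k) ⟩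
    - 1# * (v · u)                   ≡⟨ -1*x≈-x (v · u) ⟩
    - (v · u)                        ∎

  e· : ∀ {m} (k : Fin m) (a : Vector m) → e k · a ≡ a k
  e· = Σ-δˡ

  ·-▷ : ∀ {m} (ξ : Vector m) (A : Mat m) (v : Vector m) → ξ · (A ▷ v) ≡ (ξ ◁ A) · v
  ·-▷ {m} ξ A v = begin
    Σ[ (λ k → ξ k * Σ[ (λ l → A k l * v l) ]) ]
      ≡⟨ Σ-cong (λ k → Σ-*ˡ (ξ k) (λ l → A k l * v l)) ⟨
    Σ[ (λ k → Σ[ (λ l → ξ k * (A k l * v l)) ]) ]
      ≡⟨ Σ-comm {m} {m} _ ⟩
    Σ[ (λ l → Σ[ (λ k → ξ k * (A k l * v l)) ]) ]
      ≡⟨ Σ-cong (λ l → trans (Σ-cong (λ k → sym (*-assoc (ξ k) (A k l) (v l))))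
                             (Σ-*ʳ (v l) (λ k → ξ k * A k l))) ⟩
    Σ[ (λ l → Σ[ (λ k → ξ k * A k l) ] * v l) ]
      ∎

  ▷-⊗ : ∀ {m} (A B : Mat m) (v : Vector m) → ((A ⊗ B) ▷ v) ≗ (A ▷ (B ▷ v))
  ▷-⊗ A B v i = sym (·-▷ (A i) B v)

  ◁-⊗ : ∀ {m} (A B : Mat m) (ξ : Vector m) → (ξ ◁ (A ⊗ B)) ≗ ((ξ ◁ A) ◁ B)
  ◁-⊗ A B ξ j = ·-▷ ξ A (λ l → B l j)

  ▷-congˡ : ∀ {m} {A B : Mat m} → A ≈M B → ∀ v → (A ▷ v) ≗ (B ▷ v)
  ▷-congˡ A≈B v i = ·-cong (A≈B i) (λ _ → refl)

  ◁-congʳ : ∀ {m} {A B : Mat m} → A ≈M B → ∀ ξ → (ξ ◁ A) ≗ (ξ ◁ B)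
  ◁-congʳ A≈B ξ j = ·-cong (λ _ → refl) (λ k → A≈B k j)

  I▷ : ∀ {m} (v : Vector m) → (I ▷ v) ≗ v
  I▷ v i = Σ-δˡ i v

  ◁I : ∀ {m} (ξ : Vector m) → (ξ ◁ I) ≗ ξ
  ◁I ξ j = Σ-δʳ j ξ

  ▷-zero : ∀ {m} (A : Mat m) → (A ▷ (λ _ → 0#)) ≗ (λ _ → 0#)
  ▷-zero {m} A i = trans (Σ-cong (λ k → zeroʳ (A i k))) (Σ-zero m)

  ◁-zero : ∀ {m} (A : Mat m) → ((λ _ → 0#) ◁ A) ≗ (λ _ → 0#)
  ◁-zero {m} A j = trans (Σ-cong (λ k → zeroˡ (A k j))) (Σ-zero m)

  ▷-inverse : ∀ {m} {g h : Mat m} → (h ⊗ g) ≈M I → ∀ x → (h ▷ (g ▷ x)) ≗ x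
  ▷-inverse {g = g} {h} h⊗g≈I x i = begin
    (h ▷ (g ▷ x)) i  ≡⟨ ▷-⊗ h g x i ⟨
    ((h ⊗ g) ▷ x) i  ≡⟨ ▷-congˡ h⊗g≈I x i ⟩
    (I ▷ x) i        ≡⟨ I▷ x i ⟩
    x i              ∎

  ◁-inverse : ∀ {m} {g h : Mat m} → (h ⊗ g) ≈M I → ∀ ξ → ((ξ ◁ h) ◁ g) ≗ ξ
  ◁-inverse {g = g} {h} h⊗g≈I ξ j = begin
    ((ξ ◁ h) ◁ g) j  ≡⟨ ◁-⊗ h g ξ j ⟨
    (ξ ◁ (h ⊗ g)) j  ≡⟨ ◁-congʳ h⊗g≈I ξ j ⟩
    (ξ ◁ I) j        ≡⟨ ◁I ξ j ⟩
    ξ j              ∎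

  ≈M-setoid : ℕ → Setoid 0ℓ 0ℓ
  ≈M-setoid m = record
    { Carrier       = Mat m
    ; _≈_           = _≈M_
    ; isEquivalence = record
      { refl  = λ i j → refl
      ; sym   = λ A≈B i j → sym (A≈B i j)
      ; trans = λ A≈B B≈C i j → trans (A≈B i j) (B≈C i j)
      }
    }

  ⊗-assoc : ∀ {m} (A B C : Mat m) → ((A ⊗ B) ⊗ C) ≈M (A ⊗ (B ⊗ C))
  ⊗-assoc A B C i j = ▷-⊗ A B (λ k → C k j) i

  ⊗-congˡ : ∀ {m} (A : Mat m) {B B' : Mat m} → B ≈M B' → (A ⊗ B) ≈M (A ⊗ B')
  ⊗-congˡ A B≈B' i j = ·-cong (λ _ → refl) (λ k → B≈B' k j)

  ⊗-congʳ : ∀ {m} {A A' : Mat m} (B : Mat m) → A ≈M A' → (A ⊗ B) ≈M (A' ⊗ B)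
  ⊗-congʳ B A≈A' i j = ·-cong (A≈A' i) (λ _ → refl)

  ⊗-identityˡ : ∀ {m} (A : Mat m) → (I ⊗ A) ≈M A
  ⊗-identityˡ A i j = Σ-δˡ i (λ k → A k j)

  ⊗-inverse : ∀ {m} {A A' B B' : Mat m} → (A ⊗ A') ≈M I → (B ⊗ B') ≈M I →
              ((A ⊗ B) ⊗ (B' ⊗ A')) ≈M I
  ⊗-inverse {m} {A} {A'} {B} {B'} A⊗A'≈I B⊗B'≈I = begin≈
    (A ⊗ B) ⊗ (B' ⊗ A')  ≈⟨ ⊗-assoc A B (B' ⊗ A') ⟩
    A ⊗ (B ⊗ (B' ⊗ A'))  ≈⟨ ⊗-congˡ A (λ i j → sym (⊗-assoc B B' A' i j)) ⟩
    A ⊗ ((B ⊗ B') ⊗ A')  ≈⟨ ⊗-congˡ A (⊗-congʳ A' B⊗B'≈I) ⟩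
    A ⊗ (I ⊗ A')         ≈⟨ ⊗-congˡ A (⊗-identityˡ A') ⟩
    A ⊗ A'               ≈⟨ A⊗A'≈I ⟩
    I                    ∎≈
    where open SetoidReasoning (≈M-setoid m) renaming (begin_ to begin≈_; _∎ to _∎≈)

  InversePair-⊗ : ∀ {m} {g₁ h₁ g₂ h₂ : Mat m} → InversePair g₁ h₁ → InversePair g₂ h₂ →
                  InversePair (g₂ ⊗ g₁) (h₁ ⊗ h₂)
  InversePair-⊗ (g₁h₁ , h₁g₁) (g₂h₂ , h₂g₂) = ⊗-inverse g₂h₂ g₁h₁ , ⊗-inverse h₁g₁ h₂g₂

  outer-cong : ∀ {m} {x x' ξ ξ' : Vector m} → x ≗ x' → ξ ≗ ξ' → outer x ξ ≈M outer x' ξ'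
  outer-cong x≗x' ξ≗ξ' r s = cong₂ _*_ (x≗x' r) (ξ≗ξ' s)

  Tr-cong : ∀ {m} {A B : Mat m} → A ≈M B → ∀ M → Tr (A ⊗ M) ≡ Tr (B ⊗ M)
  Tr-cong A≈B M = Σ-cong (λ k → ⊗-congʳ M A≈B k k)

  Tr-scale : ∀ {m} {A B : Mat m} {c} → A ≈M scale c B → ∀ M → Tr (A ⊗ M) ≡ c * Tr (B ⊗ M)
  Tr-scale {A = A} {B} {c} A≈cB M = begin
    Tr (A ⊗ M)                                     ≡⟨ Tr-cong A≈cB M ⟩
    Σ[ (λ k → Σ[ (λ l → (c * B k l) * M l k) ]) ]
      ≡⟨ Σ-cong (λ k → trans (Σ-cong (λ l → *-assoc c (B k l) (M l k)))
                             (Σ-*ˡ c (λ l → B k l * M l k))) ⟩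
    Σ[ (λ k → c * (B ⊗ M) k k) ]                   ≡⟨ Σ-*ˡ c (λ k → (B ⊗ M) k k) ⟩
    c * Tr (B ⊗ M)                                 ∎

  Tr-outer : ∀ {m} (x ξ : Vector m) (A : Mat m) → Tr (outer x ξ ⊗ A) ≡ (ξ ◁ A) · x
  Tr-outer x ξ A = Σ-cong λ k → begin
    Σ[ (λ l → (x k * ξ l) * A l k) ]
      ≡⟨ Σ-cong (λ l → solve 3 (λ x ξ a → (x :* ξ) :* a := (ξ :* a) :* x) refl (x k) (ξ l) (A l k)) ⟩
    Σ[ (λ l → (ξ l * A l k) * x k) ]  ≡⟨ Σ-*ʳ (x k) (λ l → ξ l * A l k) ⟩
    (ξ ◁ A) k * x k                   ∎

  Tr-outer-conj : ∀ {m} (x ξ : Vector m) (g h M : Mat m) →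
                  Tr (outer x ξ ⊗ ((h ⊗ M) ⊗ g)) ≡ Tr (outer (g ▷ x) (ξ ◁ h) ⊗ M)
  Tr-outer-conj x ξ g h M = begin
    Tr (outer x ξ ⊗ ((h ⊗ M) ⊗ g))  ≡⟨ Tr-outer x ξ ((h ⊗ M) ⊗ g) ⟩
    (ξ ◁ ((h ⊗ M) ⊗ g)) · x
      ≡⟨ ·-cong (λ j → trans (◁-⊗ (h ⊗ M) g ξ j) (·-cong (◁-⊗ h M ξ) (λ _ → refl))) (λ _ → refl) ⟩
    (((ξ ◁ h) ◁ M) ◁ g) · x         ≡⟨ ·-▷ ((ξ ◁ h) ◁ M) g x ⟨
    ((ξ ◁ h) ◁ M) · (g ▷ x)         ≡⟨ Tr-outer (g ▷ x) (ξ ◁ h) M ⟨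
    Tr (outer (g ▷ x) (ξ ◁ h) ⊗ M)  ∎

  Tr-unit : ∀ {m} (A : Mat m) a b → Tr (A ⊗ outer (e a) (e b)) ≡ A b a
  Tr-unit A a b = begin
    Σ[ (λ k → Σ[ (λ l → A k l * (I a l * I b k)) ]) ]
      ≡⟨ Σ-cong (λ k → Σ-cong (λ l →
           solve 3 (λ x y z → x :* (y :* z) := y :* (x :* z)) refl (A k l) (I a l) (I b k))) ⟩
    Σ[ (λ k → Σ[ (λ l → I a l * (A k l * I b k)) ]) ]
      ≡⟨ Σ-cong (λ k → Σ-δˡ a (λ l → A k l * I b k)) ⟩
    Σ[ (λ k → A k a * I b k) ]  ≡⟨ Σ-cong (λ k → *-comm (A k a) (I b k)) ⟩
    Σ[ (λ k → I b k * A k a) ]  ≡⟨ Σ-δˡ b (λ k → A k a) ⟩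
    A b a                       ∎

  Tr-separates : ∀ {m} {A B : Mat m} → (∀ M → Tr (A ⊗ M) ≡ Tr (B ⊗ M)) → A ≈M B
  Tr-separates {A = A} {B} A≡B i j = begin
    A i j                       ≡⟨ Tr-unit A j i ⟨
    Tr (A ⊗ outer (e j) (e i))  ≡⟨ A≡B (outer (e j) (e i)) ⟩
    Tr (B ⊗ outer (e j) (e i))  ≡⟨ Tr-unit B j i ⟩
    B i j                       ∎

  transvection : ∀ {m} → Vector m → Vector m → Mat m
  transvection u v i j = I i j + u i * v j

  transvection-▷ : ∀ {m} (u v z : Vector m) →
                   (transvection u v ▷ z) ≗ (λ r → z r + u r * (v · z))
  transvection-▷ u v z r = begin
    Σ[ (λ k → (I r k + u r * v k) * z k) ]
      ≡⟨ Σ-cong (λ k → solve 4 (λ δ u v z → (δ :+ u :* v) :* z := δ :* z :+ u :* (v :* z))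
                               refl (I r k) (u r) (v k) (z k)) ⟩
    Σ[ (λ k → I r k * z k + u r * (v k * z k)) ]
      ≡⟨ Σ-+ (λ k → I r k * z k) (λ k → u r * (v k * z k)) ⟩
    Σ[ (λ k → I r k * z k) ] + Σ[ (λ k → u r * (v k * z k)) ]
      ≡⟨ cong₂ _+_ (Σ-δˡ r z) (Σ-*ˡ (u r) (λ k → v k * z k)) ⟩
    z r + u r * (v · z)
      ∎

  transvection-◁ : ∀ {m} (u v ξ : Vector m) →
                   (ξ ◁ transvection u v) ≗ (λ s → ξ s + (ξ · u) * v s)
  transvection-◁ u v ξ s = begin
    Σ[ (λ k → ξ k * (I k s + u k * v s)) ]
      ≡⟨ Σ-cong (λ k → solve 4 (λ ξ δ u v → ξ :* (δ :+ u :* v) := ξ :* δ :+ (ξ :* u) :* v)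
                               refl (ξ k) (I k s) (u k) (v s)) ⟩
    Σ[ (λ k → ξ k * I k s + (ξ k * u k) * v s) ]
      ≡⟨ Σ-+ (λ k → ξ k * I k s) (λ k → (ξ k * u k) * v s) ⟩
    Σ[ (λ k → ξ k * I k s) ] + Σ[ (λ k → (ξ k * u k) * v s) ]
      ≡⟨ cong₂ _+_ (Σ-δʳ s ξ) (Σ-*ʳ (v s) (λ k → ξ k * u k)) ⟩
    ξ s + (ξ · u) * v s
      ∎

  transvection-⊗ : ∀ {m} (a b c : Vector m) → b · c ≡ 0# →
                   (transvection a b ⊗ transvection c b) ≈M transvection (λ k → a k + c k) b
  transvection-⊗ a b c b·c≡0 i j = begin
    (transvection a b ▷ col) i              ≡⟨ transvection-▷ a b col i ⟩
    col i + a i * (b ◁ transvection c b) j  ≡⟨ cong (λ t → col i + a i * t) (transvection-◁ c b b j) ⟩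
    col i + a i * (b j + (b · c) * b j)     ≡⟨ cong (λ t → col i + a i * (b j + t * b j)) b·c≡0 ⟩
    col i + a i * (b j + 0# * b j)
      ≡⟨ cong (λ t → col i + a i * t) (trans (cong (b j +_) (zeroˡ (b j))) (+-identityʳ (b j))) ⟩
    (I i j + c i * b j) + a i * b j
      ≡⟨ solve 4 (λ δ a b c → (δ :+ c :* b) :+ a :* b := δ :+ (a :+ c) :* b) refl (I i j) (a i) (b j) (c i) ⟩
    I i j + (a i + c i) * b j               ∎
    where
    col : Vector _
    col k = transvection c b k j

  transvection-zero : ∀ {m} {a : Vector m} (b : Vector m) → (∀ k → a k ≡ 0#) → transvection a b ≈M I
  transvection-zero {a = a} b a≡0 i j = begin
    I i j + a i * b j  ≡⟨ cong (λ t → I i j + t * b j) (a≡0 i) ⟩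
    I i j + 0# * b j   ≡⟨ cong (I i j +_) (zeroˡ (b j)) ⟩
    I i j + 0#         ≡⟨ +-identityʳ (I i j) ⟩
    I i j              ∎

  transvection-inverse : ∀ {m} (u v : Vector m) → v · u ≡ 0# →
                         InversePair (transvection u v) (transvection (map -_ u) v)
  transvection-inverse u v v·u≡0 =
      (λ i j → trans (transvection-⊗ u v (map -_ u) v·-u≡0 i j)
                     (transvection-zero v (λ k → -‿inverseʳ (u k)) i j))
    , (λ i j → trans (transvection-⊗ (map -_ u) v u v·u≡0 i j)
                     (transvection-zero v (λ k → -‿inverseˡ (u k)) i j))
    where
    v·-u≡0 : v · map -_ u ≡ 0#
    v·-u≡0 = trans (·-neg v u) (trans (cong -_ v·u≡0) -0#≈0#)

  Flag : ∀ {m} → Vector m → Vector m → Set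
  Flag x ξ = NonZeroVec x × NonZeroVec ξ × ξ · x ≡ 0#

  flag-act : ∀ {m} {g h : Mat m} {x ξ : Vector m} → InversePair g h → Flag x ξ →
             Flag (g ▷ x) (ξ ◁ h)
  flag-act {g = g} {h} {x} {ξ} (_ , h⊗g≈I) (x≢0 , ξ≢0 , ξ·x≡0) = gx≢0 , ξh≢0 , ξh·gx≡0
    where
    gx≢0 : NonZeroVec (g ▷ x)
    gx≢0 gx≡0 = x≢0 λ k →
      trans (sym (▷-inverse h⊗g≈I x k)) (trans (·-cong (λ _ → refl) gx≡0) (▷-zero h k))
    ξh≢0 : NonZeroVec (ξ ◁ h)
    ξh≢0 ξh≡0 = ξ≢0 λ k →
      trans (sym (◁-inverse h⊗g≈I ξ k)) (trans (·-cong ξh≡0 (λ _ → refl)) (◁-zero g k))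
    ξh·gx≡0 : (ξ ◁ h) · (g ▷ x) ≡ 0#
    ξh·gx≡0 = begin
      (ξ ◁ h) · (g ▷ x)  ≡⟨ ·-▷ ξ h (g ▷ x) ⟨
      ξ · (h ▷ (g ▷ x))  ≡⟨ ·-cong (λ _ → refl) (▷-inverse h⊗g≈I x) ⟩
      ξ · x              ≡⟨ ξ·x≡0 ⟩
      0#                 ∎

  nonzero-entry : ∀ {m} {a : Vector m} → NonZeroVec a → ∃ λ k → a k ≢ 0#
  nonzero-entry {m} {a} a≢0 = ¬∀⟶∃¬ m (λ k → a k ≡ 0#) (λ k → a k ≟ 0#) a≢0

  nonvanishing-form : ∀ {m} {a b : Vector m} → NonZeroVec a → NonZeroVec b →
                      ∃ λ w → w · a ≢ 0# × w · b ≢ 0#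
  nonvanishing-form {a = a} {b} a≢0 b≢0 with nonzero-entry a≢0 | nonzero-entry b≢0
  ... | k , aₖ≢0 | l , bₗ≢0 with b k ≟ 0# | a l ≟ 0#
  ... | no bₖ≢0  | _        = e k , ≢0-resp (e· k a) aₖ≢0 , ≢0-resp (e· k b) bₖ≢0
  ... | yes _    | no aₗ≢0  = e l , ≢0-resp (e· l a) aₗ≢0 , ≢0-resp (e· l b) bₗ≢0
  ... | yes bₖ≡0 | yes aₗ≡0 =
      w
    , ≢0-resp (trans (w· a) (trans (cong (a k +_) aₗ≡0) (+-identityʳ (a k)))) aₖ≢0
    , ≢0-resp (trans (w· b) (trans (cong (_+ b l) bₖ≡0) (+-identityˡ (b l)))) bₗ≢0
    where
    w : Vector _
    w r = e k r + e l r
    w· : ∀ v → w · v ≡ v k + v l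
    w· v = trans (·-+ˡ (e k) (e l) v) (cong₂ _+_ (e· k v) (e· l v))

  -- With p = w · a and s = w · b, the vector d = s⁻¹ b − p⁻¹ a satisfies w · d = 0 and
  -- a + p d = (p s⁻¹) b, so the transvection I + d wᵀ sends a to a multiple of b.
  module Shift {m} {a b w : Vector m} (w·a≢0 : w · a ≢ 0#) (w·b≢0 : w · b ≢ 0#) where
    p⁻¹ s⁻¹ : Carrier
    p⁻¹ = proj₁ (inverse (w · a) w·a≢0)
    s⁻¹ = proj₁ (inverse (w · b) w·b≢0)

    d : Vector m
    d k = s⁻¹ * b k + (- p⁻¹) * a k

    c : Carrier
    c = (w · a) * s⁻¹

    c≢0 : c ≢ 0#
    c≢0 = *-≢0 w·a≢0 (*≡1⇒≢0 (proj₂ (inverse (w · b) w·b≢0)))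

    ·d : ∀ v → v · d ≡ s⁻¹ * (v · b) + (- p⁻¹) * (v · a)
    ·d v = begin
      v · d
        ≡⟨ Σ-cong (λ k → distribˡ (v k) (s⁻¹ * b k) ((- p⁻¹) * a k)) ⟩
      Σ[ (λ k → v k * (s⁻¹ * b k) + v k * ((- p⁻¹) * a k)) ]
        ≡⟨ Σ-+ (λ k → v k * (s⁻¹ * b k)) (λ k → v k * ((- p⁻¹) * a k)) ⟩
      v · (λ k → s⁻¹ * b k) + v · (λ k → (- p⁻¹) * a k)
        ≡⟨ cong₂ _+_ (·-scaleʳ v b s⁻¹) (·-scaleʳ v a (- p⁻¹)) ⟩
      s⁻¹ * (v · b) + (- p⁻¹) * (v · a)
        ∎

    -p⁻¹*p≡-1 : (- p⁻¹) * (w · a) ≡ - 1#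
    -p⁻¹*p≡-1 = trans (sym (-‿distribˡ-* p⁻¹ (w · a)))
                      (cong -_ (trans (*-comm p⁻¹ (w · a)) (proj₂ (inverse (w · a) w·a≢0))))

    w·d≡0 : w · d ≡ 0#
    w·d≡0 = begin
      w · d                              ≡⟨ ·d w ⟩
      s⁻¹ * (w · b) + (- p⁻¹) * (w · a)
        ≡⟨ cong₂ _+_ (trans (*-comm s⁻¹ (w · b)) (proj₂ (inverse (w · b) w·b≢0))) -p⁻¹*p≡-1 ⟩
      1# + - 1#                          ≡⟨ -‿inverseʳ 1# ⟩
      0#                                 ∎

    d·y≡0 : ∀ {y} → a · y ≡ 0# → b · y ≡ 0# → d · y ≡ 0#
    d·y≡0 {y} a·y≡0 b·y≡0 = begin
      d · y                              ≡⟨ ·-comm d y ⟩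
      y · d                              ≡⟨ ·d y ⟩
      s⁻¹ * (y · b) + (- p⁻¹) * (y · a)
        ≡⟨ cong₂ (λ s t → s⁻¹ * s + (- p⁻¹) * t) (trans (·-comm y b) b·y≡0) (trans (·-comm y a) a·y≡0) ⟩
      s⁻¹ * 0# + (- p⁻¹) * 0#            ≡⟨ cong₂ _+_ (zeroʳ s⁻¹) (zeroʳ (- p⁻¹)) ⟩
      0# + 0#                            ≡⟨ +-identityʳ 0# ⟩
      0#                                 ∎

    shift : ∀ k → a k + d k * (w · a) ≡ c * b k
    shift k = begin
      a k + (s⁻¹ * b k + (- p⁻¹) * a k) * (w · a)
        ≡⟨ solve 5 (λ a s b n p → a :+ (s :* b :+ n :* a) :* p := p :* s :* b :+ (a :+ (n :* p) :* a))
                   refl (a k) s⁻¹ (b k) (- p⁻¹) (w · a) ⟩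
      c * b k + (a k + ((- p⁻¹) * (w · a)) * a k)  ≡⟨ cong (λ t → c * b k + (a k + t * a k)) -p⁻¹*p≡-1 ⟩
      c * b k + (a k + - 1# * a k)                 ≡⟨ cong (λ t → c * b k + (a k + t)) (-1*x≈-x (a k)) ⟩
      c * b k + (a k + - a k)                      ≡⟨ cong (c * b k +_) (-‿inverseʳ (a k)) ⟩
      c * b k + 0#                                 ≡⟨ +-identityʳ (c * b k) ⟩
      c * b k                                      ∎

  move-point : ∀ {m} {x y : Vector m} → NonZeroVec x → NonZeroVec y →
               ∃ λ g → ∃ λ h → InversePair g h × ∃ λ α → α ≢ 0# × (g ▷ x) ≗ (λ r → α * y r)
  move-point {x = x} {y} x≢0 y≢0 with nonvanishing-form x≢0 y≢0
  ... | w , w·x≢0 , w·y≢0 =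
      transvection d w , transvection (map -_ d) w , transvection-inverse d w w·d≡0
    , c , c≢0 , λ r → trans (transvection-▷ d w x r) (shift r)
    where open Shift {a = x} {y} {w} w·x≢0 w·y≢0

  move-hyperplane : ∀ {m} {y ξ η : Vector m} → NonZeroVec ξ → NonZeroVec η →
                    ξ · y ≡ 0# → η · y ≡ 0# →
                    ∃ λ g → ∃ λ h → InversePair g h × (g ▷ y) ≗ y ×
                      ∃ λ μ → μ ≢ 0# × (ξ ◁ h) ≗ (λ s → μ * η s)
  move-hyperplane {y = y} {ξ} {η} ξ≢0 η≢0 ξ·y≡0 η·y≡0 with nonvanishing-form ξ≢0 η≢0
  ... | w , w·ξ≢0 , w·η≢0 =
      transvection (map -_ w) d , transvection w d
    , swap (transvection-inverse w d (trans (·-comm d w) w·d≡0))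
    , fixes-y , c , c≢0 , moves-ξ
    where
    open Shift {a = ξ} {η} {w} w·ξ≢0 w·η≢0

    fixes-y : (transvection (map -_ w) d ▷ y) ≗ y
    fixes-y r = begin
      (transvection (map -_ w) d ▷ y) r  ≡⟨ transvection-▷ (map -_ w) d y r ⟩
      y r + (- w r) * (d · y)            ≡⟨ cong (λ t → y r + (- w r) * t) (d·y≡0 ξ·y≡0 η·y≡0) ⟩
      y r + (- w r) * 0#                 ≡⟨ cong (y r +_) (zeroʳ (- w r)) ⟩
      y r + 0#                           ≡⟨ +-identityʳ (y r) ⟩
      y r                                ∎

    moves-ξ : (ξ ◁ transvection w d) ≗ (λ s → c * η s)
    moves-ξ s = begin
      (ξ ◁ transvection w d) s  ≡⟨ transvection-◁ w d ξ s ⟩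
      ξ s + (ξ · w) * d s       ≡⟨ cong (ξ s +_) (trans (*-comm (ξ · w) (d s)) (cong (d s *_) (·-comm ξ w))) ⟩
      ξ s + d s * (w · ξ)       ≡⟨ shift s ⟩
      c * η s                   ∎

  ·-scaled-orthogonal : ∀ {m} {ξ v y : Vector m} {α} → α ≢ 0# → v ≗ (λ r → α * y r) →
                        ξ · v ≡ 0# → ξ · y ≡ 0#
  ·-scaled-orthogonal {ξ = ξ} {v} {y} {α} α≢0 v≗αy ξ·v≡0 = ≢0*x≡0⇒x≡0 α≢0 (begin
    α * (ξ · y)          ≡⟨ ·-scaleʳ ξ y α ⟨
    ξ · (λ r → α * y r)  ≡⟨ ·-cong (λ _ → refl) v≗αy ⟨
    ξ · v                ≡⟨ ξ·v≡0 ⟩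
    0#                   ∎)

  outer-composite-move : ∀ {m} {g₁ g₂ h₁ h₂ : Mat m} {x ξ y η : Vector m} {α μ} →
    (g₁ ▷ x) ≗ (λ r → α * y r) → (g₂ ▷ y) ≗ y → ((ξ ◁ h₁) ◁ h₂) ≗ (λ s → μ * η s) →
    outer ((g₂ ⊗ g₁) ▷ x) (ξ ◁ (h₁ ⊗ h₂)) ≈M scale (α * μ) (outer y η)
  outer-composite-move {g₁ = g₁} {g₂} {h₁} {h₂} {x} {ξ} {y} {η} {α} {μ}
                       g₁x≗αy g₂y≗y ξh₁h₂≗μη r s = begin
    ((g₂ ⊗ g₁) ▷ x) r * (ξ ◁ (h₁ ⊗ h₂)) s
      ≡⟨ cong₂ _*_ (trans (▷-⊗ g₂ g₁ x r) (·-cong (λ _ → refl) g₁x≗αy)) (◁-⊗ h₁ h₂ ξ s) ⟩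
    (g₂ ▷ (λ k → α * y k)) r * ((ξ ◁ h₁) ◁ h₂) s
      ≡⟨ cong₂ _*_ (trans (·-scaleʳ (g₂ r) y α) (cong (α *_) (g₂y≗y r))) (ξh₁h₂≗μη s) ⟩
    (α * y r) * (μ * η s)
      ≡⟨ solve 4 (λ α y μ η → (α :* y) :* (μ :* η) := (α :* μ) :* (y :* η)) refl α (y r) μ (η s) ⟩
    (α * μ) * (y r * η s)
      ∎

  flag-transitive : ∀ {m} {x ξ y η : Vector m} → Flag x ξ → Flag y η →
                    ∃ λ g → ∃ λ h → InversePair g h × ∃ λ c → c ≢ 0# ×
                      outer (g ▷ x) (ξ ◁ h) ≈M scale c (outer y η)
  flag-transitive xξ@(x≢0 , _) (y≢0 , η≢0 , η·y≡0) =
    let g₁ , h₁ , g₁h₁ , α , α≢0 , g₁x≗αy = move-point x≢0 y≢0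
        _ , ξh₁≢0 , ξh₁·g₁x≡0 = flag-act g₁h₁ xξ
        ξh₁·y≡0 = ·-scaled-orthogonal α≢0 g₁x≗αy ξh₁·g₁x≡0
        g₂ , h₂ , g₂h₂ , g₂y≗y , μ , μ≢0 , ξh₁h₂≗μη = move-hyperplane ξh₁≢0 η≢0 ξh₁·y≡0 η·y≡0
    in g₂ ⊗ g₁ , h₁ ⊗ h₂ , InversePair-⊗ g₁h₁ g₂h₂ , α * μ , *-≢0 α≢0 μ≢0
     , outer-composite-move g₁x≗αy g₂y≗y ξh₁h₂≗μη

  scalar-fixes-flags : ∀ {m} {g h : Mat m} → InversePair g h → IsScalar g →
                       ∀ x ξ → outer (g ▷ x) (ξ ◁ h) ≈M outer x ξ
  scalar-fixes-flags {g = g} {h} (_ , h⊗g≈I) (c , g≈cI) x ξ r s = begin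
    (g ▷ x) r * (ξ ◁ h) s  ≡⟨ cong (_* (ξ ◁ h) s) (scalar-▷ x r) ⟩
    (c * x r) * (ξ ◁ h) s  ≡⟨ solve 3 (λ c x η → (c :* x) :* η := x :* (η :* c)) refl c (x r) ((ξ ◁ h) s) ⟩
    x r * ((ξ ◁ h) s * c)  ≡⟨ cong (x r *_) (scalar-◁ (ξ ◁ h) s) ⟨
    x r * ((ξ ◁ h) ◁ g) s  ≡⟨ cong (x r *_) (◁-inverse h⊗g≈I ξ s) ⟩
    x r * ξ s              ∎
    where
    scalar-▷ : ∀ v → (g ▷ v) ≗ (λ r → c * v r)
    scalar-▷ v r = trans (·-cong (g≈cI r) (λ _ → refl)) (begin
      Σ[ (λ k → (c * I r k) * v k) ]
        ≡⟨ Σ-cong (λ k → solve 3 (λ c δ v → (c :* δ) :* v := δ :* (c :* v)) refl c (I r k) (v k)) ⟩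
      Σ[ (λ k → I r k * (c * v k)) ]  ≡⟨ Σ-δˡ r (λ k → c * v k) ⟩
      c * v r                         ∎)
    scalar-◁ : ∀ η → (η ◁ g) ≗ (λ s → η s * c)
    scalar-◁ η s = trans (·-cong (λ _ → refl) (λ k → g≈cI k s)) (begin
      Σ[ (λ k → η k * (c * I k s)) ]
        ≡⟨ Σ-cong (λ k → solve 3 (λ c δ η → η :* (c :* δ) := (η :* c) :* δ) refl c (I k s) (η k)) ⟩
      Σ[ (λ k → (η k * c) * I k s) ]  ≡⟨ Σ-δʳ s (λ k → η k * c) ⟩
      η s * c                         ∎)

  -- The flags (e k, e l) with k ≢ l give g b k * h l a = δ k b * δ l a: g is diagonal and
  -- g k k * h l l = 1 whenever k ≢ l, while h k k * g k k = 1 from h ⊗ g ≈ I, so the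
  -- diagonal is constant.
  flag-fixing⇒scalar : ∀ {n} {g h : Mat (suc n)} → InversePair g h →
                       (∀ {x ξ} → Flag x ξ → outer (g ▷ x) (ξ ◁ h) ≈M outer x ξ) → IsScalar g
  flag-fixing⇒scalar {g = g} {h} (_ , h⊗g≈I) fixes = g zero zero , g≈scalar
    where
    e≢0 : ∀ k → NonZeroVec (e k)
    e≢0 k eₖ≡0 = 0≢1 (trans (sym (eₖ≡0 k)) (I-diag k))

    basis-flag : ∀ {k l} → k ≢ l → Flag (e k) (e l)
    basis-flag {k} {l} k≢l = e≢0 k , e≢0 l , trans (e· l (e k)) (I-off k≢l)

    entry : ∀ {k l} → k ≢ l → ∀ a b → g b k * h l a ≡ I k b * I l a
    entry {k} {l} k≢l a b = begin
      g b k * h l a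
        ≡⟨ cong₂ _*_ (trans (·-comm (g b) (e k)) (e· k (g b))) (e· l (λ r → h r a)) ⟨
      (g ▷ e k) b * (e l ◁ h) a  ≡⟨ fixes (basis-flag k≢l) b a ⟩
      I k b * I l a              ∎

    diagonal-product : ∀ {k l} → k ≢ l → g k k * h l l ≡ 1#
    diagonal-product {k} {l} k≢l = begin
      g k k * h l l  ≡⟨ entry k≢l l k ⟩
      I k k * I l l  ≡⟨ cong₂ _*_ (I-diag k) (I-diag l) ⟩
      1# * 1#        ≡⟨ *-identityˡ 1# ⟩
      1#             ∎

    off-diagonal : ∀ {b k} → b ≢ k → g b k ≡ 0#
    off-diagonal {b} {k} b≢k = ≢0*x≡0⇒x≡0 (*≡1⇒≢0 (diagonal-product k≢b)) (begin
      h b b * g b k  ≡⟨ *-comm (h b b) (g b k) ⟩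
      g b k * h b b  ≡⟨ entry k≢b b b ⟩
      I k b * I b b  ≡⟨ cong (_* I b b) (I-off k≢b) ⟩
      0# * I b b     ≡⟨ zeroˡ (I b b) ⟩
      0#             ∎)
      where k≢b = b≢k ∘ sym

    diagonal : ∀ j k → g j k ≡ g k k * I j k
    diagonal j k with j ≟ᶠ k
    ... | yes refl = sym (*-identityʳ (g k k))
    ... | no j≢k   = trans (off-diagonal j≢k) (sym (zeroʳ (g k k)))

    diagonal-inverse : ∀ k → h k k * g k k ≡ 1#
    diagonal-inverse k = begin
      h k k * g k k                         ≡⟨ Σ-δʳ k (λ j → h k j * g k k) ⟨
      Σ[ (λ j → (h k j * g k k) * I j k) ]
        ≡⟨ Σ-cong (λ j → trans (*-assoc (h k j) (g k k) (I j k)) (cong (h k j *_) (sym (diagonal j k)))) ⟩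
      (h ⊗ g) k k                           ≡⟨ h⊗g≈I k k ⟩
      I k k                                 ≡⟨ I-diag k ⟩
      1#                                    ∎

    diagonal-constant : ∀ {k l} → k ≢ l → g k k ≡ g l l
    diagonal-constant {k} {l} k≢l = begin
      g k k                    ≡⟨ *-identityʳ (g k k) ⟨
      g k k * 1#               ≡⟨ cong (g k k *_) (diagonal-inverse l) ⟨
      g k k * (h l l * g l l)  ≡⟨ *-assoc (g k k) (h l l) (g l l) ⟨
      (g k k * h l l) * g l l  ≡⟨ cong (_* g l l) (diagonal-product k≢l) ⟩
      1# * g l l               ≡⟨ *-identityˡ (g l l) ⟩
      g l l                    ∎

    g≈scalar : g ≈M scale (g zero zero) I
    g≈scalar i j with j ≟ᶠ zero
    ... | yes refl = diagonal i zero
    ... | no j≢0   = trans (diagonal i j) (cong (_* I i j) (diagonal-constant j≢0))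

  indicator : Carrier → ℕ
  indicator a = if does (a ≟ 0#) then 0 else 1

  weight≡sum : ∀ {N} (w : Fin N → Carrier) → weight w ≡ ℕΣ.sum (indicator ∘ w)
  weight≡sum {zero}  w = refl
  weight≡sum {suc N} w = cong (indicator (w zero) ℕ.+_) (weight≡sum (w ∘ suc))

  weight-cong-zeros : ∀ {N} {w w' : Fin N → Carrier} → (∀ i → (w i ≡ 0#) ⇔ (w' i ≡ 0#)) →
                      weight w ≡ weight w'
  weight-cong-zeros {w = w} {w'} w⇔w' = begin
    weight w                 ≡⟨ weight≡sum w ⟩
    ℕΣ.sum (indicator ∘ w)
      ≡⟨ ℕΣ.sum-cong-≗ (λ i → cong (λ b → if b then 0 else 1) (does-⇔ (w⇔w' i) (w i ≟ 0#) (w' i ≟ 0#))) ⟩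
    ℕΣ.sum (indicator ∘ w')  ≡⟨ weight≡sum w' ⟨
    weight w'                ∎

  weight-permute : ∀ {N} (σ τ : Fin N → Fin N) → (∀ i → σ (τ i) ≡ i) → (∀ i → τ (σ i) ≡ i) →
                   ∀ (w : Fin N → Carrier) → weight (w ∘ σ) ≡ weight w
  weight-permute σ τ στ τσ w = begin
    weight (w ∘ σ)              ≡⟨ weight≡sum (w ∘ σ) ⟩
    ℕΣ.sum (indicator ∘ w ∘ σ)  ≡⟨ ℕΣ.sum-permute (indicator ∘ w) (permutation σ τ στ τσ) ⟨
    ℕΣ.sum (indicator ∘ w)      ≡⟨ weight≡sum w ⟨
    weight w                    ∎

  weight-monomial : ∀ {N} {w w' : Fin N → Carrier} (σ τ : Fin N → Fin N) →
                    (∀ i → σ (τ i) ≡ i) → (∀ i → τ (σ i) ≡ i) →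
                    (c : Fin N → Carrier) → (∀ i → c i ≢ 0#) → (∀ i → w (σ i) ≡ c i * w' i) →
                    weight w' ≡ weight w
  weight-monomial {w = w} {w'} σ τ στ τσ c c≢0 wσ≡cw' =
    trans (weight-cong-zeros same-zeros) (weight-permute σ τ στ τσ w)
    where
    same-zeros : ∀ i → (w' i ≡ 0#) ⇔ (w (σ i) ≡ 0#)
    same-zeros i = mk⇔ (λ w'ᵢ≡0 → trans (wσ≡cw' i) (trans (cong (c i *_) w'ᵢ≡0) (zeroʳ (c i))))
                       (λ wσᵢ≡0 → ≢0*x≡0⇒x≡0 (c≢0 i) (trans (sym (wσ≡cw' i)) wσᵢ≡0))

  module Λ₁Code {n N : ℕ} (X : Fin N → Mat (suc n)) (sys : IsΛ₁System X) where
    x ξ : Fin N → Vector (suc n)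
    x i = proj₁ (proj₁ sys i)
    ξ i = proj₁ (proj₂ (proj₁ sys i))

    flag : ∀ i → Flag (x i) (ξ i)
    flag i = let (_ , _ , x≢0 , ξ≢0 , ξ·x≡0 , _) = proj₁ sys i in x≢0 , ξ≢0 , ξ·x≡0

    X≈outer : ∀ i → X i ≈M outer (x i) (ξ i)
    X≈outer i = let (_ , _ , _ , _ , _ , X≈xξ) = proj₁ sys i in X≈xξ

    codeword-conj : ∀ g h M i → codeword X ((h ⊗ M) ⊗ g) i ≡ Tr (outer (g ▷ x i) (ξ i ◁ h) ⊗ M)
    codeword-conj g h M i =
      trans (Tr-cong (X≈outer i) ((h ⊗ M) ⊗ g)) (Tr-outer-conj (x i) (ξ i) g h M)

    locate : ∀ {y η} → Flag y η →
             ∃ λ k → ∃ λ c → c ≢ 0# × ∀ M → codeword X M k ≡ c * Tr (outer y η ⊗ M)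
    locate (y≢0 , η≢0 , η·y≡0) =
      let k , c , c≢0 , Xₖ≈c[yη] = proj₂ (proj₂ sys) _ _ y≢0 η≢0 η·y≡0
      in k , c , c≢0 , Tr-scale Xₖ≈c[yη]

    position-unique : ∀ {i j c} → c ≢ 0# → (∀ M → codeword X M i ≡ c * codeword X M j) → i ≡ j
    position-unique {i} {j} {c} c≢0 cᵢ≡c*cⱼ = proj₁ (proj₂ sys) i j (c , c≢0 , Xᵢ≈cXⱼ)
      where
      Xᵢ≈cXⱼ : X i ≈M scale c (X j)
      Xᵢ≈cXⱼ = Tr-separates λ M → trans (cᵢ≡c*cⱼ M) (sym (Tr-scale {B = X j} (λ _ _ → refl) M))

    conj-cancel : ∀ {g h} → InversePair g h → ∀ M i →
                  codeword X ((h ⊗ ((g ⊗ M) ⊗ h)) ⊗ g) i ≡ codeword X M i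
    conj-cancel {g} {h} (_ , h⊗g≈I) M i = begin
      codeword X ((h ⊗ ((g ⊗ M) ⊗ h)) ⊗ g) i          ≡⟨ codeword-conj g h ((g ⊗ M) ⊗ h) i ⟩
      Tr (outer (g ▷ x i) (ξ i ◁ h) ⊗ ((g ⊗ M) ⊗ h))  ≡⟨ Tr-outer-conj (g ▷ x i) (ξ i ◁ h) h g M ⟩
      Tr (outer (h ▷ (g ▷ x i)) ((ξ i ◁ h) ◁ g) ⊗ M)
        ≡⟨ Tr-cong (outer-cong (▷-inverse {g = g} {h} h⊗g≈I (x i)) (◁-inverse {g = g} {h} h⊗g≈I (ξ i))) M ⟩
      Tr (outer (x i) (ξ i) ⊗ M)                      ≡⟨ Tr-cong (X≈outer i) M ⟨
      codeword X M i                                  ∎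

    code-invariant : ∀ g h → InversePair g h → ∀ M → ∃ λ M' →
                     ∀ i → codeword X ((h ⊗ M') ⊗ g) i ≡ codeword X M i
    code-invariant g h gh M = (g ⊗ M) ⊗ h , conj-cancel {g} {h} gh M

    scalar-acts-trivially : ∀ g h → InversePair g h → IsScalar g → ∀ M i →
                            codeword X ((h ⊗ M) ⊗ g) i ≡ codeword X M i
    scalar-acts-trivially g h gh g-scalar M i = begin
      codeword X ((h ⊗ M) ⊗ g) i
        ≡⟨ codeword-conj g h M i ⟩
      Tr (outer (g ▷ x i) (ξ i ◁ h) ⊗ M)
        ≡⟨ Tr-cong (scalar-fixes-flags {g = g} {h} gh g-scalar (x i) (ξ i)) M ⟩
      Tr (outer (x i) (ξ i) ⊗ M)
        ≡⟨ Tr-cong (X≈outer i) M ⟨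
      codeword X M i
        ∎

    acts-trivially⇒scalar : ∀ g h → InversePair g h →
                            (∀ M i → codeword X ((h ⊗ M) ⊗ g) i ≡ codeword X M i) → IsScalar g
    acts-trivially⇒scalar g h gh trivial = flag-fixing⇒scalar {g = g} {h} gh fixes
      where
      fixes : ∀ {y η} → Flag y η → outer (g ▷ y) (η ◁ h) ≈M outer y η
      fixes {y} {η} yη =
        let k , c , c≢0 , cₖ≡c[yη] = locate yη
        in Tr-separates λ M → *-cancelˡ-≢0 c≢0 (begin
          c * Tr (outer (g ▷ y) (η ◁ h) ⊗ M)  ≡⟨ cong (c *_) (Tr-outer-conj y η g h M) ⟨
          c * Tr (outer y η ⊗ ((h ⊗ M) ⊗ g))  ≡⟨ cₖ≡c[yη] ((h ⊗ M) ⊗ g) ⟨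
          codeword X ((h ⊗ M) ⊗ g) k          ≡⟨ trivial M k ⟩
          codeword X M k                      ≡⟨ cₖ≡c[yη] M ⟩
          c * Tr (outer y η ⊗ M)              ∎)

    codeword-moved : ∀ {i j c} g h → outer (g ▷ x i) (ξ i ◁ h) ≈M scale c (outer (x j) (ξ j)) →
                     ∀ M → codeword X ((h ⊗ M) ⊗ g) i ≡ c * codeword X M j
    codeword-moved {i} {j} {c} g h gxᵢ⊗ξᵢh≈c[xⱼ⊗ξⱼ] M = begin
      codeword X ((h ⊗ M) ⊗ g) i          ≡⟨ codeword-conj g h M i ⟩
      Tr (outer (g ▷ x i) (ξ i ◁ h) ⊗ M)  ≡⟨ Tr-scale gxᵢ⊗ξᵢh≈c[xⱼ⊗ξⱼ] M ⟩
      c * Tr (outer (x j) (ξ j) ⊗ M)      ≡⟨ cong (c *_) (Tr-cong (X≈outer j) M) ⟨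
      c * codeword X M j                  ∎

    transitive : ∀ i j → ∃ λ g → ∃ λ h → InversePair g h × ∃ λ c → c ≢ 0# ×
                 ∀ M → codeword X ((h ⊗ M) ⊗ g) i ≡ c * codeword X M j
    transitive i j =
      let g , h , gh , c , c≢0 , moves = flag-transitive (flag i) (flag j)
      in g , h , gh , c , c≢0 , codeword-moved g h moves

    module Monomial (g h : Mat (suc n)) (gh : InversePair g h) where
      located : ∀ i → ∃ λ k → ∃ λ c → c ≢ 0# ×
                  ∀ M → codeword X M k ≡ c * Tr (outer (g ▷ x i) (ξ i ◁ h) ⊗ M)
      located i = locate (flag-act {g = g} {h} gh (flag i))

      σ : Fin N → Fin N
      σ i = proj₁ (located i)

      coeff : Fin N → Carrier
      coeff i = proj₁ (proj₂ (located i))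

      coeff≢0 : ∀ i → coeff i ≢ 0#
      coeff≢0 i = proj₁ (proj₂ (proj₂ (located i)))

      codeword-σ : ∀ M i → codeword X M (σ i) ≡ coeff i * codeword X ((h ⊗ M) ⊗ g) i
      codeword-σ M i =
        trans (proj₂ (proj₂ (proj₂ (located i))) M) (cong (coeff i *_) (sym (codeword-conj g h M i)))

    -- hg is a separate argument rather than swap gh: otherwise the second use would need
    -- swap (swap gh) ≡ gh under σ, which Agda only checks after unfolding σ (very slowly).
    σ-inverse : ∀ g h (gh : InversePair g h) (hg : InversePair h g) i →
                Monomial.σ g h gh (Monomial.σ h g hg i) ≡ i
    σ-inverse g h gh hg i = position-unique (*-≢0 (A.coeff≢0 (B.σ i)) (B.coeff≢0 i)) λ M → begin
      codeword X M (A.σ (B.σ i))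
        ≡⟨ A.codeword-σ M (B.σ i) ⟩
      A.coeff (B.σ i) * codeword X ((h ⊗ M) ⊗ g) (B.σ i)
        ≡⟨ cong (A.coeff (B.σ i) *_) (B.codeword-σ ((h ⊗ M) ⊗ g) i) ⟩
      A.coeff (B.σ i) * (B.coeff i * codeword X ((g ⊗ ((h ⊗ M) ⊗ g)) ⊗ h) i)
        ≡⟨ cong (λ t → A.coeff (B.σ i) * (B.coeff i * t)) (conj-cancel {h} {g} hg M i) ⟩
      A.coeff (B.σ i) * (B.coeff i * codeword X M i)
        ≡⟨ *-assoc (A.coeff (B.σ i)) (B.coeff i) (codeword X M i) ⟨
      (A.coeff (B.σ i) * B.coeff i) * codeword X M i
        ∎
      where
      module A = Monomial g h gh
      module B = Monomial h g hg

    weight-preserving : ∀ g h → InversePair g h → ∀ M →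
                        weight (codeword X ((h ⊗ M) ⊗ g)) ≡ weight (codeword X M)
    weight-preserving g h gh M =
      weight-monomial {w = codeword X M} {codeword X ((h ⊗ M) ⊗ g)} A.σ B.σ
        (σ-inverse g h gh (swap gh)) (σ-inverse h g (swap gh) gh)
        A.coeff A.coeff≢0 (A.codeword-σ M)
      where
      module A = Monomial g h gh
      module B = Monomial h g (swap gh)

proposition3p11 : ∀ {q} (F : FiniteField q) (n N : ℕ) →
    let open FiniteField F
        open LinAlg F
    in (X : Fin N → Mat (suc n)) → IsΛ₁System X →
      -- for g ∈ GL(n+1,q) with inverse h = g⁻¹, the map c_M ↦ c_{g⁻¹ M g}
      -- preserves Hamming weights ...
      (∀ (g h : Mat (suc n)) → InversePair g h → ∀ M →
         weight (codeword X ((h ⊗ M) ⊗ g)) ≡ weight (codeword X M))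
      -- ... and maps the code onto itself,
      × (∀ (g h : Mat (suc n)) → InversePair g h → ∀ M → ∃ λ M' →
           ∀ i → codeword X ((h ⊗ M') ⊗ g) i ≡ codeword X M i)
      -- the action factors through PGL: scalar g act trivially ...
      × (∀ (g h : Mat (suc n)) → InversePair g h → IsScalar g → ∀ M i →
           codeword X ((h ⊗ M) ⊗ g) i ≡ codeword X M i)
      -- ... and only scalar g act trivially (PGL acts faithfully),
      × (∀ (g h : Mat (suc n)) → InversePair g h →
           (∀ M i → codeword X ((h ⊗ M) ⊗ g) i ≡ codeword X M i) → IsScalar g)
      -- and the group is transitive on coordinate positions: for any
      -- positions i, j some g moves component j to component i
      -- (up to a nonzero scalar, as for a monomial automorphism).
      × (∀ (i j : Fin N) → ∃ λ g → ∃ λ h → InversePair g h × ∃ λ c → c ≢ 0# ×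
           ∀ M → codeword X ((h ⊗ M) ⊗ g) i ≡ c * codeword X M j)
proposition3p11 F n N X sys =
  weight-preserving , code-invariant , scalar-acts-trivially , acts-trivially⇒scalar , transitive
  where open Λ₁Code F X sys
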